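{- Let $A$ be a finite group, let $B$ be a subgroup of $A$ of index $2$, and let $H$ and $K$ be subgroups of $A$ with $1<H\le K<A$ and $H\le B$. Then the number of subsets $S\subseteq A\setminus B$ such that $S\setminus K$ is a union of cosets $xH$ ($x\in A$) is at most $2^{\frac{3|A|}{8}}$. -}

module Defs where

open import Data.Nat using (ℕ)
open import Data.Fin using (Fin)
open import Data.Fin.Subset using (Subset; _∈_; _∉_; ∣_∣)
open import Data.Product using (_×_; ∃-syntax; Σ-syntax)
open import Relation.Binary.PropositionalEquality using (_≡_; _≢_)
open import Algebra.Structures using (IsGroup)
open import Function.Bundles using (_⇔_)

-- A finite group of order n, presented on the carrier Fin n
-- (every finite group is isomorphic to one of this form).
record FinGroup (n : ℕ) : Set where
  field
    _∙_     : Fin n → Fin n → Fin n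
    ε       : Fin n
    _⁻¹     : Fin n → Fin n
    isGroup : IsGroup _≡_ _∙_ ε _⁻¹

module _ {n : ℕ} (G : FinGroup n) where
  open FinGroup G

  record IsSubgroup (H : Subset n) : Set where
    field
      ε-closed   : ε ∈ H
      ∙-closed   : ∀ {x y} → x ∈ H → y ∈ H → (x ∙ y) ∈ H
      ⁻¹-closed  : ∀ {x} → x ∈ H → (x ⁻¹) ∈ H

  _·_ : Fin n → Subset n → Fin n → Set
  (x · H) a = ∃[ h ] (h ∈ H × a ≡ x ∙ h)

  IsUnionOfCosets : (Fin n → Set) → Subset n → Set
  IsUnionOfCosets U H = ∃[ X ] (∀ a → U a ⇔ (∃[ x ] (x ∈ X × (x · H) a)))

_∖_ : {n : ℕ} → Subset n → Subset n → Fin n → Set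
(S ∖ K) a = a ∈ S × a ∉ K

DisjointFrom : {n : ℕ} → Subset n → Subset n → Set
DisjointFrom S B = ∀ a → a ∈ S → a ∉ B

-- An admissible S avoids B, and since H ≤ B ∩ K it contains either all or none of
-- each coset xH lying outside B ∪ K. So S is determined by its trace on K ∖ B together
-- with one representative of each such coset: at most 2^(k + m) sets, where k = |K ∖ B|
-- and m is the number of these cosets. Left translation by an element of K ∖ B maps
-- K ∖ B into K ∩ B, and K is proper, so 4k ≤ |A|; as |H| ≥ 2, the cosets give
-- 2m + k + |B| ≤ |A|. With |A| = 2|B| these combine to 8(k + m) ≤ 3|A|.
module Submission where

open import Defs
open import Level using (0ℓ)
open import Data.Nat using (ℕ; zero; suc; _+_; _*_; _^_; _≤_; z≤n)
open import Data.Nat.Properties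
open import Data.Bool using (true; false)
open import Data.Fin using (Fin; toℕ)
import Data.Fin as Fin
open import Data.Fin.Properties using (toℕ-injective; all?; injective⇒≤; 2↔Bool; finToFun-funToFin)
open import Data.Fin.Base using (funToFin; finToFun)
open import Data.Fin.Subset using (Subset; _∈_; _∉_; _⊆_; ∣_∣; inside)
open import Data.Fin.Subset.Properties using (_∈?_; ⊆-antisym)
open import Data.Vec using (_∷_; [])
import Data.Vec as Vec
open import Data.Vec.Properties using (lookup⇒[]=; []=⇒lookup)
open import Data.List using (List; []; _∷_; length; map; _++_; filter; tabulate; allFin; lookup)
open import Data.List.Properties using (length-map; length-++)
open import Data.List.Relation.Unary.All as All using (All)
open import Data.List.Relation.Unary.Any using (here; index)
open import Data.List.Relation.Unary.Any.Properties using (lookup-index)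
open import Data.List.Relation.Unary.AllPairs using (_∷_)
open import Data.List.Relation.Unary.Unique.Propositional using (Unique)
import Data.List.Relation.Unary.Unique.Propositional.Properties as Unique
import Data.List.Membership.Propositional as List
open import Data.List.Membership.Propositional.Properties
  using (∈-lookup; ∈-map⁺; ∈-map⁻; ∈-++⁺ˡ; ∈-++⁺ʳ; ∈-++⁻; ∈-filter⁺; ∈-filter⁻; ∈-allFin)
import Data.List.Extrema
open import Data.Product using (_×_; _,_; ∃-syntax; proj₁; proj₂)
open import Data.Sum using (inj₁; inj₂)
open import Data.Empty using (⊥-elim)
open import Function using (Inverse)
open import Function.Bundles using (Equivalence)
open import Relation.Nullary using (¬_; yes; no; does)
open import Relation.Nullary.Decidable using (_×-dec_; ¬?; _→-dec_)
open import Relation.Unary using (Pred; Decidable)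
open import Relation.Binary.PropositionalEquality
open import Algebra.Bundles using (Group)
import Algebra.Properties.Group as GroupProperties
open import Data.Nat.Tactic.RingSolver using (solve-∀)

module _ {A : Set} where

  lookup-injective : {xs : List A} → Unique xs → ∀ {i j} → lookup xs i ≡ lookup xs j → i ≡ j
  lookup-injective (_ ∷ _) {Fin.zero} {Fin.zero} _ = refl
  lookup-injective (x≢ ∷ _) {Fin.zero} {Fin.suc j} eq = ⊥-elim (All.lookup x≢ (∈-lookup j) eq)
  lookup-injective (x≢ ∷ _) {Fin.suc i} {Fin.zero} eq = ⊥-elim (All.lookup x≢ (∈-lookup i) (sym eq))
  lookup-injective (_ ∷ u) {Fin.suc i} {Fin.suc j} eq = cong Fin.suc (lookup-injective u eq)

  length≤-injectiveOn : ∀ {m} {xs : List A} (f : A → Fin m) →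
                        (∀ {x y} → x List.∈ xs → y List.∈ xs → f x ≡ f y → x ≡ y) →
                        Unique xs → length xs ≤ m
  length≤-injectiveOn f inj u =
    injective⇒≤ (λ eq → lookup-injective u (inj (∈-lookup _) (∈-lookup _) eq))

  Unique-++⁺-separated : {P : Pred A 0ℓ} {xs ys : List A} → Unique xs → Unique ys →
                         (∀ {x} → x List.∈ xs → P x) → (∀ {y} → y List.∈ ys → ¬ P y) →
                         Unique (xs ++ ys)
  Unique-++⁺-separated uxs uys P-xs ¬P-ys = Unique.++⁺ uxs uys λ (x∈xs , x∈ys) → ¬P-ys x∈ys (P-xs x∈xs)

  Unique-++-map⁺ : {P : Pred A 0ℓ} {xs : List A} (f : A → A) → (∀ {x y} → f x ≡ f y → x ≡ y) →
                   Unique xs → (∀ {x} → x List.∈ xs → P x) → (∀ {x} → x List.∈ xs → ¬ P (f x)) →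
                   Unique (xs ++ map f xs)
  Unique-++-map⁺ {P} f f-inj u P-xs ¬P-fxs = Unique-++⁺-separated u (Unique.map⁺ f-inj u) P-xs ¬P-image
    where
    ¬P-image : ∀ {y} → y List.∈ map f _ → ¬ P y
    ¬P-image y∈ with ∈-map⁻ f y∈
    ... | x , x∈xs , refl = ¬P-fxs x∈xs

  length-++-map : (f : A → A) (xs : List A) → length (xs ++ map f xs) ≡ length xs + length xs
  length-++-map f xs = trans (length-++ xs) (cong (length xs +_) (length-map f xs))

module _ {n : ℕ} where

  Unique⇒length≤ : {xs : List (Fin n)} → Unique xs → length xs ≤ n
  Unique⇒length≤ = length≤-injectiveOn (λ x → x) (λ _ _ eq → eq)

  module _ {P : Pred (Fin n) 0ℓ} (P? : Decidable P) where

    members : List (Fin n)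
    members = filter P? (allFin n)

    members-unique : Unique members
    members-unique = Unique.filter⁺ P? (Unique.allFin⁺ n)

    ∈-members⁺ : ∀ {x} → P x → x List.∈ members
    ∈-members⁺ px = ∈-filter⁺ P? (∈-allFin _) px

    ∈-members⁻ : ∀ {x} → x List.∈ members → P x
    ∈-members⁻ x∈ = proj₂ (∈-filter⁻ P? {xs = allFin n} x∈)

length-filter-∈-tabulate : ∀ {m n} s (p : Subset n) (f : Fin m → Fin n) →
  length (filter (_∈? (s ∷ p)) (tabulate (λ i → Fin.suc (f i)))) ≡ length (filter (_∈? p) (tabulate f))
length-filter-∈-tabulate {zero} s p f = refl
length-filter-∈-tabulate {suc m} s p f with does (f Fin.zero ∈? p)
... | true = cong suc (length-filter-∈-tabulate s p (λ i → f (Fin.suc i)))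
... | false = length-filter-∈-tabulate s p (λ i → f (Fin.suc i))

∣p∣≡length-members : ∀ {n} (p : Subset n) → ∣ p ∣ ≡ length (members (_∈? p))
∣p∣≡length-members [] = refl
∣p∣≡length-members (true ∷ p) =
  cong suc (trans (∣p∣≡length-members p) (sym (length-filter-∈-tabulate true p (λ i → i))))
∣p∣≡length-members (false ∷ p) =
  trans (∣p∣≡length-members p) (sym (length-filter-∈-tabulate false p (λ i → i)))

module FinGroupProperties {n : ℕ} (G : FinGroup n) where

  open FinGroup G

  group : Group 0ℓ 0ℓ
  group = record { isGroup = isGroup }

  open Group group using (identityʳ; assoc)
  open GroupProperties group
    using (∙-cancelˡ; ∙-cancelʳ; ⁻¹-involutive; \\-leftDividesˡ; //-rightDividesʳ)
    public

  module _ {T : Subset n} (T≤G : IsSubgroup G T) where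
    open IsSubgroup T≤G

    ⁻¹-∈⁻ : ∀ {x} → (x ⁻¹) ∈ T → x ∈ T
    ⁻¹-∈⁻ {x} x⁻¹∈T = subst (_∈ T) (⁻¹-involutive x) (⁻¹-closed x⁻¹∈T)

    ∙-∈⁻ʳ : ∀ {x y} → y ∈ T → (x ∙ y) ∈ T → x ∈ T
    ∙-∈⁻ʳ {x} {y} y∈T xy∈T = subst (_∈ T) (//-rightDividesʳ y x) (∙-closed xy∈T (⁻¹-closed y∈T))

    -- T and its translate a T are disjoint when a ∉ T.
    ∉-subgroup⇒length+length≤ : ∀ {a} → a ∉ T → {ys : List (Fin n)} → Unique ys →
                                 (∀ {y} → y List.∈ ys → y ∈ T) → length ys + length ys ≤ n
    ∉-subgroup⇒length+length≤ {a} a∉T {ys} u ys⊆T =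
      subst (_≤ n) (length-++-map (a ∙_) ys)
        (Unique⇒length≤ (Unique-++-map⁺ (a ∙_) (∙-cancelˡ a _ _) u ys⊆T
          (λ y∈ys ay∈T → a∉T (∙-∈⁻ʳ (ys⊆T y∈ys) ay∈T))))

  -- Otherwise y, B and x⁻¹ B would be n + 1 distinct elements.
  index₂-∉-∙-closed : ∀ {B} → IsSubgroup G B → ∣ B ∣ * 2 ≡ n →
                      ∀ {x y} → x ∉ B → y ∉ B → (x ∙ y) ∈ B
  index₂-∉-∙-closed {B} B≤G ∣B∣*2≡n {x} {y} x∉B y∉B with (x ∙ y) ∈? B
  ... | yes xy∈B = xy∈B
  ... | no xy∉B = ⊥-elim (<-irrefl refl (subst₂ _≤_ len (sym ∣B∣*2≡n) (Unique⇒length≤ distinct)))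
    where
    bs = members (_∈? B)

    distinct : Unique (y ∷ (bs ++ map ((x ⁻¹) ∙_) bs))
    distinct = All.tabulate y≢ ∷ Unique-++-map⁺ ((x ⁻¹) ∙_) (∙-cancelˡ (x ⁻¹) _ _)
                 (members-unique _) (∈-members⁻ _)
                 (λ b∈ x⁻¹b∈B → x∉B (⁻¹-∈⁻ B≤G (∙-∈⁻ʳ B≤G (∈-members⁻ _ b∈) x⁻¹b∈B)))
      where
      y≢ : ∀ {z} → z List.∈ bs ++ map ((x ⁻¹) ∙_) bs → y ≢ z
      y≢ z∈ refl with ∈-++⁻ bs z∈
      ... | inj₁ y∈bs = y∉B (∈-members⁻ _ y∈bs)
      ... | inj₂ y∈x⁻¹bs with ∈-map⁻ ((x ⁻¹) ∙_) y∈x⁻¹bs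
      ...   | b , b∈bs , refl = xy∉B (subst (_∈ B) (sym (\\-leftDividesˡ x b)) (∈-members⁻ _ b∈bs))

    m*2≡m+m : ∀ m → m * 2 ≡ m + m
    m*2≡m+m = solve-∀

    len : length (y ∷ (bs ++ map ((x ⁻¹) ∙_) bs)) ≡ suc (∣ B ∣ * 2)
    len = cong suc (trans (length-++-map _ bs)
            (trans (cong (λ k → k + k) (sym (∣p∣≡length-members B))) (sym (m*2≡m+m ∣ B ∣))))

  module _ {H : Subset n} (H≤G : IsSubgroup G H) where
    open IsSubgroup H≤G

    ∈cosets-∙-closed : ∀ {U : Fin n → Set} → IsUnionOfCosets G U H →
                      ∀ {x h} → U x → h ∈ H → U (x ∙ h)
    ∈cosets-∙-closed (X , U⇔) {x} {h} Ux h∈H with Equivalence.to (U⇔ x) Ux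
    ... | r , r∈X , h′ , h′∈H , refl =
      Equivalence.from (U⇔ ((r ∙ h′) ∙ h)) (r , r∈X , h′ ∙ h , ∙-closed h′∈H h∈H , assoc r h′ h)

    -- Taking the element of least index in each coset x H is a decidable choice of representatives.
    Least : Fin n → Set
    Least x = ∀ h → h ∈ H → toℕ x ≤ toℕ (x ∙ h)

    least? : Decidable Least
    least? x = all? (λ h → (h ∈? H) →-dec (toℕ x ≤? toℕ (x ∙ h)))

    least-exists : ∀ y → ∃[ h ] (h ∈ H × Least (y ∙ h))
    least-exists y = h , h∈H , least
      where
      open Data.List.Extrema ≤-totalOrder using (argmin; argmin-all; f[argmin]≤f[xs])
      coset : List (Fin n)
      coset = map (y ∙_) (members (_∈? H))
      InCoset : Fin n → Set
      InCoset z = ∃[ h ] (h ∈ H × z ≡ y ∙ h)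
      in-coset : InCoset (argmin toℕ y coset)
      in-coset = argmin-all toℕ {P = InCoset} (ε , ε-closed , sym (identityʳ y))
        (All.tabulate λ z∈ → let (h , h∈ , eq) = ∈-map⁻ (y ∙_) z∈ in h , ∈-members⁻ (_∈? H) h∈ , eq)
      h = proj₁ in-coset
      h∈H = proj₁ (proj₂ in-coset)
      least : Least (y ∙ h)
      least h′ h′∈H = subst (λ z → toℕ z ≤ toℕ ((y ∙ h) ∙ h′)) (proj₂ (proj₂ in-coset))
        (subst (λ z → toℕ (argmin toℕ y coset) ≤ toℕ z) (sym (assoc y h h′))
          (All.lookup (f[argmin]≤f[xs] {f = toℕ} y coset)
            (∈-map⁺ (y ∙_) (∈-members⁺ _ (∙-closed h∈H h′∈H)))))

    least-∙-least⇒≡ε : ∀ {x h} → h ∈ H → Least x → Least (x ∙ h) → h ≡ ε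
    least-∙-least⇒≡ε {x} {h} h∈H least-x least-xh = ∙-cancelˡ x h ε (trans xh≡x (sym (identityʳ x)))
      where
      xh≡x : x ∙ h ≡ x
      xh≡x = toℕ-injective (≤-antisym
        (subst (λ z → toℕ (x ∙ h) ≤ toℕ z) (//-rightDividesʳ h x) (least-xh (h ⁻¹) (⁻¹-closed h∈H)))
        (least-x h h∈H))

8*[k+m]≤3*n : ∀ {k m N n} → (k + k) + (k + k) ≤ n → (m + m) + (k + N) ≤ n → N * 2 ≡ n →
              (k + m) * 8 ≤ 3 * n
8*[k+m]≤3*n {k} {m} {N} {n} 4k≤n 2m+k+N≤n N*2≡n = +-cancelʳ-≤ (N * 4) ((k + m) * 8) (3 * n) (begin
  (k + m) * 8 + N * 4                           ≡⟨ regroup k m N ⟩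
  ((m + m) + (k + N)) * 4 + ((k + k) + (k + k)) ≤⟨ +-mono-≤ (*-monoˡ-≤ 4 2m+k+N≤n) 4k≤n ⟩
  n * 4 + n                                     ≡⟨ cong (λ z → z * 4 + z) (sym N*2≡n) ⟩
  N * 2 * 4 + N * 2                             ≡⟨ regroup′ N ⟩
  3 * (N * 2) + N * 4                           ≡⟨ cong (λ z → 3 * z + N * 4) N*2≡n ⟩
  3 * n + N * 4                                 ∎)
  where
  open ≤-Reasoning
  regroup : ∀ k m N → (k + m) * 8 + N * 4 ≡ ((m + m) + (k + N)) * 4 + ((k + k) + (k + k))
  regroup = solve-∀
  regroup′ : ∀ N → N * 2 * 4 + N * 2 ≡ 3 * (N * 2) + N * 4
  regroup′ = solve-∀

module AdmissibleSets {n : ℕ} (G : FinGroup n) {B H K : Subset n}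
  (B≤G : IsSubgroup G B) (∣B∣*2≡n : ∣ B ∣ * 2 ≡ n)
  (H≤G : IsSubgroup G H) (K≤G : IsSubgroup G K) (H⊆K : H ⊆ K) (H⊆B : H ⊆ B) where

  open FinGroup G
  open FinGroupProperties G
  open IsSubgroup

  Admissible : Subset n → Set
  Admissible S = DisjointFrom S B × IsUnionOfCosets G (S ∖ K) H

  K∖B? : Decidable (λ x → x ∈ K × x ∉ B)
  K∖B? x = (x ∈? K) ×-dec ¬? (x ∈? B)

  representative? : Decidable (λ x → (x ∉ B × x ∉ K) × Least H≤G x)
  representative? x = (¬? (x ∈? B) ×-dec ¬? (x ∈? K)) ×-dec least? H≤G x

  -- An admissible set is determined by its intersection with free.
  free : List (Fin n)
  free = members K∖B? ++ members representative?

  ∙H-∉ : ∀ {T} → IsSubgroup G T → H ⊆ T → ∀ {x h} → h ∈ H → x ∉ T → (x ∙ h) ∉ T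
  ∙H-∉ T≤G H⊆T h∈H x∉T xh∈T = x∉T (∙-∈⁻ʳ T≤G (H⊆T h∈H) xh∈T)

  K∖B-bound : ∀ {a} → a ∉ K → {xs : List (Fin n)} → Unique xs →
              (∀ {x} → x List.∈ xs → x ∈ K × x ∉ B) →
              (length xs + length xs) + (length xs + length xs) ≤ n
  K∖B-bound a∉K {[]} _ _ = z≤n
  K∖B-bound a∉K {xs@(k₀ ∷ _)} u xs⊆K∖B =
    subst (λ l → l + l ≤ n) (length-++-map (k₀ ∙_) xs)
      (∉-subgroup⇒length+length≤ K≤G a∉K
        (Unique-++-map⁺ (k₀ ∙_) (∙-cancelˡ k₀ _ _) u (λ x∈ → proj₂ (xs⊆K∖B x∈))
          (λ x∈ k₀x∉B → k₀x∉B (index₂-∉-∙-closed B≤G ∣B∣*2≡n k₀∉B (proj₂ (xs⊆K∖B x∈)))))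
        ⊆K)
    where
    k₀∈K×k₀∉B = xs⊆K∖B (here refl)
    k₀∉B = proj₂ k₀∈K×k₀∉B
    ⊆K : ∀ {x} → x List.∈ xs ++ map (k₀ ∙_) xs → x ∈ K
    ⊆K x∈ with ∈-++⁻ xs x∈
    ... | inj₁ x∈xs = proj₁ (xs⊆K∖B x∈xs)
    ... | inj₂ x∈k₀xs with ∈-map⁻ (k₀ ∙_) x∈k₀xs
    ...   | y , y∈xs , refl = ∙-closed K≤G (proj₁ k₀∈K×k₀∉B) (proj₁ (xs⊆K∖B y∈xs))

  -- reps, reps h₀, K ∖ B and B are pairwise disjoint.
  representatives-bound : ∀ {h₀} → h₀ ∈ H → h₀ ≢ ε →
    let k = length (members K∖B?) ; m = length (members representative?) in
    (m + m) + (k + ∣ B ∣) ≤ n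
  representatives-bound {h₀} h₀∈H h₀≢ε = subst (_≤ n) len (Unique⇒length≤ distinct)
    where
    reps = members representative?
    kb = members K∖B?
    bs = members (_∈? B)

    reps-doubled : Unique (reps ++ map (_∙ h₀) reps)
    reps-doubled = Unique-++-map⁺ (_∙ h₀) (∙-cancelʳ h₀ _ _) (members-unique _)
      (λ x∈ → proj₂ (∈-members⁻ _ x∈))
      (λ x∈ least-xh₀ → h₀≢ε (least-∙-least⇒≡ε H≤G h₀∈H (proj₂ (∈-members⁻ _ x∈)) least-xh₀))

    ∉B∪K : ∀ {x} → x List.∈ reps ++ map (_∙ h₀) reps → x ∉ B × x ∉ K
    ∉B∪K x∈ with ∈-++⁻ reps x∈
    ... | inj₁ x∈reps = proj₁ (∈-members⁻ _ x∈reps)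
    ... | inj₂ x∈repsh₀ with ∈-map⁻ (_∙ h₀) x∈repsh₀
    ...   | y , y∈reps , refl = let (y∉B , y∉K) = proj₁ (∈-members⁻ _ y∈reps) in
                                ∙H-∉ B≤G H⊆B h₀∈H y∉B , ∙H-∉ K≤G H⊆K h₀∈H y∉K

    ∈B∪K : ∀ {x} → x List.∈ kb ++ bs → ¬ (x ∉ B × x ∉ K)
    ∈B∪K x∈ (x∉B , x∉K) with ∈-++⁻ kb x∈
    ... | inj₁ x∈kb = x∉K (proj₁ (∈-members⁻ _ x∈kb))
    ... | inj₂ x∈bs = x∉B (∈-members⁻ _ x∈bs)

    distinct : Unique ((reps ++ map (_∙ h₀) reps) ++ (kb ++ bs))
    distinct = Unique-++⁺-separated reps-doubled
      (Unique-++⁺-separated (members-unique _) (members-unique _)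
        (λ x∈ → proj₂ (∈-members⁻ _ x∈)) (λ x∈ x∉B → x∉B (∈-members⁻ _ x∈)))
      ∉B∪K ∈B∪K

    len : length ((reps ++ map (_∙ h₀) reps) ++ (kb ++ bs)) ≡ (length reps + length reps) + (length kb + ∣ B ∣)
    len = begin
      length ((reps ++ map (_∙ h₀) reps) ++ (kb ++ bs))       ≡⟨ length-++ (reps ++ map (_∙ h₀) reps) ⟩
      length (reps ++ map (_∙ h₀) reps) + length (kb ++ bs)   ≡⟨ cong₂ _+_ (length-++-map (_∙ h₀) reps) (length-++ kb) ⟩
      (length reps + length reps) + (length kb + length bs)   ≡⟨ cong (λ b → (length reps + length reps) + (length kb + b)) (sym (∣p∣≡length-members B)) ⟩
      (length reps + length reps) + (length kb + ∣ B ∣)       ∎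
      where open ≡-Reasoning

  admissible-⊆ : ∀ {S S′} → Admissible S → Admissible S′ →
                 (∀ {x} → x List.∈ free → x ∈ S → x ∈ S′) → S ⊆ S′
  admissible-⊆ {S} {S′} (S∩B≡∅ , S∖K-cosets) (_ , S′∖K-cosets) agree {x} x∈S with x ∈? B | x ∈? K
  ... | yes x∈B | _ = ⊥-elim (S∩B≡∅ x x∈S x∈B)
  ... | no x∉B | yes x∈K = agree (∈-++⁺ˡ (∈-members⁺ K∖B? (x∈K , x∉B))) x∈S
  ... | no x∉B | no x∉K =
    let (h , h∈H , least) = least-exists H≤G x
        xh∉B = ∙H-∉ B≤G H⊆B h∈H x∉B
        xh∉K = ∙H-∉ K≤G H⊆K h∈H x∉K
        xh∈S = proj₁ (∈cosets-∙-closed H≤G S∖K-cosets (x∈S , x∉K) h∈H)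
        xh∈S′ = agree (∈-++⁺ʳ (members K∖B?) (∈-members⁺ representative? ((xh∉B , xh∉K) , least))) xh∈S
    in subst (_∈ S′) (//-rightDividesʳ h x)
         (proj₁ (∈cosets-∙-closed H≤G S′∖K-cosets (xh∈S′ , xh∉K) (⁻¹-closed H≤G h∈H)))

  code : Subset n → Fin (2 ^ length free)
  code S = funToFin (λ i → Inverse.from 2↔Bool (Vec.lookup S (lookup free i)))

  code-≡⇒agree : ∀ {S S′} → code S ≡ code S′ → ∀ {x} → x List.∈ free → x ∈ S → x ∈ S′
  code-≡⇒agree {S} {S′} eq {x} x∈free x∈S = lookup⇒[]= x S′ (begin
    Vec.lookup S′ x ≡⟨ cong (Vec.lookup S′) x≡ ⟩
    Vec.lookup S′ (lookup free i) ≡⟨ bits-≡ ⟨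
    Vec.lookup S (lookup free i) ≡⟨ cong (Vec.lookup S) x≡ ⟨
    Vec.lookup S x ≡⟨ []=⇒lookup x∈S ⟩
    inside ∎)
    where
    open ≡-Reasoning
    i = index x∈free
    x≡ : x ≡ lookup free i
    x≡ = lookup-index x∈free
    bits-≡ : Vec.lookup S (lookup free i) ≡ Vec.lookup S′ (lookup free i)
    bits-≡ = trans (sym (Inverse.strictlyInverseˡ 2↔Bool _))
      (trans (cong (Inverse.to 2↔Bool)
        (trans (sym (finToFun-funToFin _ i)) (trans (cong (λ c → finToFun c i) eq) (finToFun-funToFin _ i))))
        (Inverse.strictlyInverseˡ 2↔Bool _))

  admissible-count : (L : List (Subset n)) → Unique L → All Admissible L → length L ≤ 2 ^ length free
  admissible-count L u adm = length≤-injectiveOn code code-injective u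
    where
    code-injective : ∀ {S S′} → S List.∈ L → S′ List.∈ L → code S ≡ code S′ → S ≡ S′
    code-injective S∈ S′∈ eq = ⊆-antisym
      (admissible-⊆ (All.lookup adm S∈) (All.lookup adm S′∈) (code-≡⇒agree eq))
      (admissible-⊆ (All.lookup adm S′∈) (All.lookup adm S∈) (code-≡⇒agree (sym eq)))

lemma3p3 : (n : ℕ) (A : FinGroup n) (B H K : Subset n)
           → IsSubgroup A B → ∣ B ∣ * 2 ≡ n
           → IsSubgroup A H → IsSubgroup A K
           → (∃[ h ] (h ∈ H × h ≢ FinGroup.ε A))
           → H ⊆ K → (∃[ a ] (a ∉ K)) → H ⊆ B
           → (L : List (Subset n)) → Unique L
           → All (λ S → DisjointFrom S B × IsUnionOfCosets A (S ∖ K) H) L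
           → length L ^ 8 ≤ 2 ^ (3 * n)
lemma3p3 n A B H K B≤A ∣B∣*2≡n H≤A K≤A (h₀ , h₀∈H , h₀≢ε) H⊆K (a , a∉K) H⊆B L u adm = begin
  length L ^ 8                        ≤⟨ ^-monoˡ-≤ 8 (admissible-count L u adm) ⟩
  (2 ^ length free) ^ 8               ≡⟨ ^-*-assoc 2 (length free) 8 ⟩
  2 ^ (length free * 8)               ≡⟨ cong (λ d → 2 ^ (d * 8)) (length-++ (members K∖B?)) ⟩
  2 ^ ((length kb + length reps) * 8) ≤⟨ ^-monoʳ-≤ 2 (8*[k+m]≤3*n {length kb} {length reps} {∣ B ∣} kb-bound reps-bound ∣B∣*2≡n) ⟩
  2 ^ (3 * n)                         ∎
  where
  open ≤-Reasoning
  open AdmissibleSets A B≤A ∣B∣*2≡n H≤A K≤A H⊆K H⊆B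
  kb = members K∖B?
  reps = members representative?
  kb-bound = K∖B-bound a∉K {kb} (members-unique K∖B?) (∈-members⁻ K∖B?)
  reps-bound = representatives-bound h₀∈H h₀≢ε
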